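{- Let $w$ be a function on pairs $(T,S)$ of equal-size subsets of $[n]$ with values in $\mathbb{R}\cup\{ -\infty\}$ satisfying properties (i)–(v) below, and such that $F(S)=w(\{1,\dots,|S|\},S)$ is submodular on $2^{[n]}$. Then $w(\{j\},\{k\})\ge w(\{j+1\},\{k\})$ for all $1\le j\le n-1$ and $1\le k\le n$. Properties: (i) $w(\{1,\dots,|S|\},S)\neq-\infty$ for all $S$; (ii) $w(T,S)=-\infty$ whenever $S\prec T$; (iii) for any interval $I$ with $\max(I)<\min(T\cup S)$, $w(I\cup T,I\cup S)=\sum_{i\in I}w(\{i\},\{i\})+w(T,S)$; (iv) if $\max(S\cup T)<t$ and $\max(S\cup T)<s$ then $w(T\cup\{t\},S\cup\{s\})=w(T,S)+w(\{t\},\{s\})$; (v) for each $S$, $T\mapsto w(T,S)$ satisfies the three-term tropical Plücker relations.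
   Context: An interval is a set of consecutive integers. For $S,T\in\binom{[n]}{k}$, $T=\{t_1<\dots<t_k\}$: $S\preceq T$ if $|\{s\in S:s\le t_j\}|\ge j$ for all $j$; $S\prec T$ if moreover $S\neq T$. Three-term tropical Plücker relations for $g$ on $\binom{[n]}{k}$: for $|R|=k-2$ and distinct $a,b,c,d\notin R$, the maximum of $g(Rab)+g(Rcd)$, $g(Rac)+g(Rbd)$, $g(Rad)+g(Rbc)$ is attained at least twice ($Rab=R\cup\{a,b\}$). Submodular: $F(A\cap B)+F(A\cup B)\le F(A)+F(B)$. -}

module Defs where

open import Data.Nat as ℕ using (ℕ; zero; suc; _<?_; _≤?_)
open import Data.Fin using (Fin; toℕ)
open import Data.Fin.Subset using (Subset; _∈_; _∉_; ∣_∣; ⁅_⁆; _∪_; _∩_)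
open import Data.Vec using ([]; _∷_; tabulate)
open import Data.Bool using (true; false; _∧_)
open import Data.Product using (_×_)
open import Data.Sum using (_⊎_)
open import Relation.Nullary using (¬_)
open import Relation.Nullary.Decidable using (⌊_⌋)
open import Relation.Binary.PropositionalEquality using (_≡_; _≢_)

-- Totally ordered abelian group (the value group; ℝ is an instance).

record OrderedAbelianGroup : Set₁ where
  infixl 6 _+_
  infix 4 _≤_
  field
    Carrier     : Set
    _+_         : Carrier → Carrier → Carrier
    0#          : Carrier
    -_          : Carrier → Carrier
    _≤_         : Carrier → Carrier → Set
    +-assoc     : ∀ x y z → (x + y) + z ≡ x + (y + z)
    +-comm      : ∀ x y → x + y ≡ y + x
    +-identityˡ : ∀ x → 0# + x ≡ x
    -‿inverseˡ  : ∀ x → (- x) + x ≡ 0#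
    ≤-refl      : ∀ x → x ≤ x
    ≤-trans     : ∀ {x y z} → x ≤ y → y ≤ z → x ≤ z
    ≤-antisym   : ∀ {x y} → x ≤ y → y ≤ x → x ≡ y
    ≤-total     : ∀ x y → x ≤ y ⊎ y ≤ x
    +-monoˡ-≤   : ∀ {x y} z → x ≤ y → x + z ≤ y + z

-- Subsets of [n] = {1,…,n}, represented by Fin n (element i ↦ i+1).

first : ∀ {n} → ℕ → Subset n
first k = tabulate (λ i → ⌊ toℕ i <? k ⌋)

interval : ∀ {n} → Fin n → Fin n → Subset n
interval a b = tabulate (λ i → ⌊ toℕ a ≤? toℕ i ⌋ ∧ ⌊ toℕ i ≤? toℕ b ⌋)

countLE : ∀ {n} → Subset n → Fin n → ℕ
countLE S t = ∣ S ∩ first (suc (toℕ t)) ∣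

-- S ⪯ T : for T = {t₁ < … < t_k}, |{s ∈ S : s ≤ t_j}| ≥ j for all j.
-- (t_j is the element t ∈ T with |{t' ∈ T : t' ≤ t}| = j.)
_⪯_ : ∀ {n} → Subset n → Subset n → Set
S ⪯ T = ∀ t → t ∈ T → countLE T t ℕ.≤ countLE S t

_≺_ : ∀ {n} → Subset n → Subset n → Set
S ≺ T = S ⪯ T × S ≢ T

-- every element of A is smaller than every element of B
-- (max A < min B, vacuous if either set is empty)
_≪_ : ∀ {n} → Subset n → Subset n → Set
A ≪ B = ∀ a b → a ∈ A → b ∈ B → toℕ a ℕ.< toℕ b

-- ℝ ∪ {-∞}, generalised to G ∪ {-∞}.

module _ (G : OrderedAbelianGroup) where
  open OrderedAbelianGroup G

  data Ext : Set where
    -∞  : Ext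
    fin : Carrier → Ext

  infixl 6 _⊕_
  _⊕_ : Ext → Ext → Ext
  -∞    ⊕ _     = -∞
  fin _ ⊕ -∞    = -∞
  fin x ⊕ fin y = fin (x + y)

  infix 4 _≤ₑ_
  data _≤ₑ_ : Ext → Ext → Set where
    -∞≤  : ∀ {x} → -∞ ≤ₑ x
    fin≤ : ∀ {x y} → x ≤ y → fin x ≤ₑ fin y

  MaxTwice : Ext → Ext → Ext → Set
  MaxTwice x y z = (x ≡ y × z ≤ₑ x) ⊎ (x ≡ z × y ≤ₑ x) ⊎ (y ≡ z × x ≤ₑ y)

  sumOver : ∀ {n} → Subset n → (Fin n → Ext) → Ext
  sumOver []          f = fin 0#
  sumOver (true  ∷ p) f = f Data.Fin.zero ⊕ sumOver p (λ i → f (Data.Fin.suc i))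
  sumOver (false ∷ p) f = sumOver p (λ i → f (Data.Fin.suc i))

  TropPlücker : ∀ {n} → ℕ → (Subset n → Ext) → Set
  TropPlücker {n} k g =
    ∀ (R : Subset n) (a b c d : Fin n) → ∣ R ∣ ℕ.+ 2 ≡ k →
    a ≢ b → a ≢ c → a ≢ d → b ≢ c → b ≢ d → c ≢ d →
    a ∉ R → b ∉ R → c ∉ R → d ∉ R →
    MaxTwice (g (R ∪ ⁅ a ⁆ ∪ ⁅ b ⁆) ⊕ g (R ∪ ⁅ c ⁆ ∪ ⁅ d ⁆))
             (g (R ∪ ⁅ a ⁆ ∪ ⁅ c ⁆) ⊕ g (R ∪ ⁅ b ⁆ ∪ ⁅ d ⁆))
             (g (R ∪ ⁅ a ⁆ ∪ ⁅ d ⁆) ⊕ g (R ∪ ⁅ b ⁆ ∪ ⁅ c ⁆))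

  Submodular : ∀ {n} → (Subset n → Ext) → Set
  Submodular {n} F = ∀ (A B : Subset n) → F (A ∩ B) ⊕ F (A ∪ B) ≤ₑ F A ⊕ F B

  -- w is only meaningful on pairs (T,S) with |T| = |S|; values elsewhere are ignored.
  record Properties {n} (w : Subset n → Subset n → Ext) : Set where
    field
      prop-i   : ∀ S → w (first ∣ S ∣) S ≢ -∞
      prop-ii  : ∀ T S → ∣ T ∣ ≡ ∣ S ∣ → S ≺ T → w T S ≡ -∞
      prop-iii : ∀ T S (a b : Fin n) → ∣ T ∣ ≡ ∣ S ∣ → toℕ a ℕ.≤ toℕ b →
                 interval a b ≪ (T ∪ S) →
                 w (interval a b ∪ T) (interval a b ∪ S)
                   ≡ sumOver (interval a b) (λ i → w ⁅ i ⁆ ⁅ i ⁆) ⊕ w T S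
      prop-iv  : ∀ T S (t s : Fin n) → ∣ T ∣ ≡ ∣ S ∣ →
                 (S ∪ T) ≪ ⁅ t ⁆ → (S ∪ T) ≪ ⁅ s ⁆ →
                 w (T ∪ ⁅ t ⁆) (S ∪ ⁅ s ⁆) ≡ w T S ⊕ w ⁅ t ⁆ ⁅ s ⁆
      prop-v   : ∀ S → TropPlücker ∣ S ∣ (λ T → w T S)

{-# OPTIONS --safe #-}
-- If k ≤ j then {k} ≺ {j+1}, so w({j+1},{k}) = -∞ by (ii). Otherwise put
-- P = {1,…,j-1} and apply submodularity of F to P ∪ {j} = [j] and P ∪ {k}.
-- By (iv), F(P ∪ {k}) = w(P,P) + w({j},{k}) and F([j] ∪ {k}) = w([j],[j]) + w({j+1},{k}),
-- while F(P) = w(P,P) and F([j]) = w([j],[j]) are finite by (i); cancelling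
-- them leaves w({j+1},{k}) ≤ w({j},{k}).
module Submission where

open import Defs
open import Data.Nat using (ℕ; suc)
open import Data.Fin using (Fin; toℕ)
open import Data.Fin.Subset using (Subset; ∣_∣; ⁅_⁆)
open import Relation.Binary.PropositionalEquality using (_≡_)

open import Algebra.Solver.IdempotentCommutativeMonoid as ICM using ()
open import Data.Bool using (true; false)
open import Data.Bool.Properties using (T-≡)
open import Data.Empty using (⊥-elim)
open import Data.Fin using (zero; suc)
open import Data.Fin.Properties using (toℕ<n)
open import Data.Fin.Subset using (_∈_; _∉_; _∪_; _∩_; ⊥)
open import Data.Fin.Subset.Properties
open import Data.Nat using (zero; _≤_; _<_; _<?_; z≤n; s≤s)
open import Data.Nat.Properties using (≤-refl; ≤-reflexive; <⇒≤; <⇒≢; ≤⇒≯; <-≤-trans; ≤-<-connex)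
open import Data.Product using (_,_)
open import Data.Sum using (inj₁; inj₂)
open import Data.Vec using ([]; _∷_; here; there)
open import Data.Vec.Properties using (tabulate-cong; lookup∘tabulate; []=⇒lookup; lookup⇒[]=)
open import Function using (_∘_; Equivalence)
open import Relation.Binary.PropositionalEquality
  using (_≢_; refl; sym; trans; cong; cong₂; subst; subst₂; module ≡-Reasoning)
open import Relation.Nullary.Decidable using (⌊_⌋; toWitness; fromWitness; isYes≗does)

first-zero : ∀ {n} → first {n} 0 ≡ ⊥
first-zero {zero}  = refl
first-zero {suc n} = cong (false ∷_) first-zero

first-suc : ∀ {n} m → first {suc n} (suc m) ≡ true ∷ first m
first-suc m = cong (true ∷_) (tabulate-cong (λ i → <?-suc (toℕ i)))
  where
  -- ⌊_⌋ is stuck on neutral arguments, but both `does` reduce to a <ᵇ m.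
  <?-suc : ∀ a → ⌊ suc a <? suc m ⌋ ≡ ⌊ a <? m ⌋
  <?-suc a = trans (isYes≗does (suc a <? suc m)) (sym (isYes≗does (a <? m)))

∈first⁻ : ∀ {n} {x : Fin n} {m} → x ∈ first m → toℕ x < m
∈first⁻ {x = x} {m} x∈first =
  toWitness (Equivalence.from T-≡ (trans (sym (lookup∘tabulate _ x)) ([]=⇒lookup x∈first)))

∈first⁺ : ∀ {n} {x : Fin n} {m} → toℕ x < m → x ∈ first m
∈first⁺ {x = x} {m} x<m =
  lookup⇒[]= x (first m) (trans (lookup∘tabulate _ x) (Equivalence.to T-≡ (fromWitness x<m)))

∣first∣ : ∀ {n} m → m ≤ n → ∣ first {n} m ∣ ≡ m
∣first∣ {n}     zero    z≤n      = trans (cong ∣_∣ (first-zero {n})) (∣⊥∣≡0 n)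
∣first∣ {suc n} (suc m) (s≤s m≤n) = trans (cong ∣_∣ (first-suc {n} m)) (cong suc (∣first∣ m m≤n))

first∪⁅x⁆≡first[1+x] : ∀ {n} (x : Fin n) → first (toℕ x) ∪ ⁅ x ⁆ ≡ first (suc (toℕ x))
first∪⁅x⁆≡first[1+x] zero = begin
  first 0 ∪ ⁅ zero ⁆   ≡⟨ cong (_∪ ⁅ zero ⁆) first-zero ⟩
  ⊥ ∪ ⁅ zero ⁆         ≡⟨ ∪-identityˡ ⁅ zero ⁆ ⟩
  true ∷ ⊥             ≡⟨ cong (true ∷_) first-zero ⟨
  true ∷ first 0       ≡⟨ first-suc 0 ⟨
  first 1              ∎
  where open ≡-Reasoning
first∪⁅x⁆≡first[1+x] (suc x) = begin
  first (suc (toℕ x)) ∪ ⁅ suc x ⁆        ≡⟨ cong (_∪ ⁅ suc x ⁆) (first-suc (toℕ x)) ⟩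
  true ∷ (first (toℕ x) ∪ ⁅ x ⁆)         ≡⟨ cong (true ∷_) (first∪⁅x⁆≡first[1+x] x) ⟩
  true ∷ first (suc (toℕ x))             ≡⟨ first-suc (suc (toℕ x)) ⟨
  first (suc (suc (toℕ x)))              ∎
  where open ≡-Reasoning

first≪⁅⁆ : ∀ {n m} {t : Fin n} → m ≤ toℕ t → first m ≪ ⁅ t ⁆
first≪⁅⁆ {t = t} m≤t a b a∈first b∈⁅t⁆ rewrite x∈⁅y⁆⇒x≡y t b∈⁅t⁆ =
  <-≤-trans (∈first⁻ a∈first) m≤t

∣p∪⁅x⁆∣≡1+∣p∣ : ∀ {n} (p : Subset n) {x} → x ∉ p → ∣ p ∪ ⁅ x ⁆ ∣ ≡ suc ∣ p ∣
∣p∪⁅x⁆∣≡1+∣p∣ (true  ∷ p) {zero}  x∉p = ⊥-elim (x∉p here)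
∣p∪⁅x⁆∣≡1+∣p∣ (false ∷ p) {zero}  x∉p = cong (λ q → suc ∣ q ∣) (∪-identityʳ p)
∣p∪⁅x⁆∣≡1+∣p∣ (true  ∷ p) {suc x} x∉p = cong suc (∣p∪⁅x⁆∣≡1+∣p∣ p (x∉p ∘ there))
∣p∪⁅x⁆∣≡1+∣p∣ (false ∷ p) {suc x} x∉p = ∣p∪⁅x⁆∣≡1+∣p∣ p (x∉p ∘ there)

⁅x⁆∩p≡⁅x⁆ : ∀ {n} {x : Fin n} {p} → x ∈ p → ⁅ x ⁆ ∩ p ≡ ⁅ x ⁆
⁅x⁆∩p≡⁅x⁆ {x = x} {p} x∈p = ⊆-antisym (p∩q⊆p ⁅ x ⁆ p)
  (λ y∈⁅x⁆ → x∈p∩q⁺ (y∈⁅x⁆ , subst (_∈ p) (sym (x∈⁅y⁆⇒x≡y x y∈⁅x⁆)) x∈p))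

⁅x⁆∩⁅y⁆≡⊥ : ∀ {n} {x y : Fin n} → x ≢ y → ⁅ x ⁆ ∩ ⁅ y ⁆ ≡ ⊥
⁅x⁆∩⁅y⁆≡⊥ {x = x} {y} x≢y = Empty-unique λ (z , z∈⁅x⁆∩⁅y⁆) →
  let z∈⁅x⁆ , z∈⁅y⁆ = x∈p∩q⁻ ⁅ x ⁆ ⁅ y ⁆ z∈⁅x⁆∩⁅y⁆
  in x≢y (trans (sym (x∈⁅y⁆⇒x≡y x z∈⁅x⁆)) (x∈⁅y⁆⇒x≡y y z∈⁅y⁆))

⁅⁆-injective : ∀ {n} {x y : Fin n} → ⁅ x ⁆ ≡ ⁅ y ⁆ → x ≡ y
⁅⁆-injective {x = x} {y} ⁅x⁆≡⁅y⁆ = x∈⁅y⁆⇒x≡y y (subst (x ∈_) ⁅x⁆≡⁅y⁆ (x∈⁅x⁆ x))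

countLE-⁅⁆ : ∀ {n} {s t : Fin n} → toℕ s ≤ toℕ t → countLE ⁅ s ⁆ t ≡ 1
countLE-⁅⁆ {s = s} s≤t = trans (cong ∣_∣ (⁅x⁆∩p≡⁅x⁆ (∈first⁺ (s≤s s≤t)))) (∣⁅x⁆∣≡1 s)

⁅⁆⪯⁅⁆ : ∀ {n} {s t : Fin n} → toℕ s ≤ toℕ t → ⁅ s ⁆ ⪯ ⁅ t ⁆
⁅⁆⪯⁅⁆ {t = t} s≤t u u∈⁅t⁆ rewrite x∈⁅y⁆⇒x≡y t u∈⁅t⁆ =
  ≤-reflexive (trans (countLE-⁅⁆ {s = t} ≤-refl) (sym (countLE-⁅⁆ s≤t)))

⁅⁆≺⁅⁆ : ∀ {n} {s t : Fin n} → toℕ s < toℕ t → ⁅ s ⁆ ≺ ⁅ t ⁆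
⁅⁆≺⁅⁆ s<t = ⁅⁆⪯⁅⁆ (<⇒≤ s<t) , <⇒≢ s<t ∘ cong toℕ ∘ ⁅⁆-injective

Submodular⇒diminishingReturns :
  ∀ (G : OrderedAbelianGroup) {n} {F : Subset n → Ext G} → Submodular G F →
  ∀ p {a b} → a ≢ b →
  _≤ₑ_ G (_⊕_ G (F p) (F ((p ∪ ⁅ a ⁆) ∪ ⁅ b ⁆))) (_⊕_ G (F (p ∪ ⁅ a ⁆)) (F (p ∪ ⁅ b ⁆)))
Submodular⇒diminishingReturns G {n} {F} submodular p {a} {b} a≢b =
  subst₂ (λ A B → _≤ₑ_ G (_⊕_ G (F A) (F B)) (_⊕_ G (F (p ∪ ⁅ a ⁆)) (F (p ∪ ⁅ b ⁆))))
         meet join (submodular (p ∪ ⁅ a ⁆) (p ∪ ⁅ b ⁆))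
  where
  meet : (p ∪ ⁅ a ⁆) ∩ (p ∪ ⁅ b ⁆) ≡ p
  meet = begin
    (p ∪ ⁅ a ⁆) ∩ (p ∪ ⁅ b ⁆) ≡⟨ ∪-distribˡ-∩ p ⁅ a ⁆ ⁅ b ⁆ ⟨
    p ∪ (⁅ a ⁆ ∩ ⁅ b ⁆)       ≡⟨ cong (p ∪_) (⁅x⁆∩⁅y⁆≡⊥ a≢b) ⟩
    p ∪ ⊥                     ≡⟨ ∪-identityʳ p ⟩
    p                         ∎
    where open ≡-Reasoning
  join : (p ∪ ⁅ a ⁆) ∪ (p ∪ ⁅ b ⁆) ≡ (p ∪ ⁅ a ⁆) ∪ ⁅ b ⁆
  join = prove 3 ((P ∙ A) ∙ (P ∙ B)) ((P ∙ A) ∙ B) (p ∷ ⁅ a ⁆ ∷ ⁅ b ⁆ ∷ [])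
    where
    open ICM (∪-idempotentCommutativeMonoid n) using (prove; var) renaming (_⊕_ to _∙_)
    P = var zero
    A = var (suc zero)
    B = var (suc (suc zero))

module _ (G : OrderedAbelianGroup) where
  open OrderedAbelianGroup G
    using (_+_; -_; 0#; +-assoc; +-comm; +-identityˡ; -‿inverseˡ; +-monoˡ-≤)
    renaming (_≤_ to _≤ᴳ_)

  +-cancelˡ-≤ : ∀ c {a b} → c + a ≤ᴳ c + b → a ≤ᴳ b
  +-cancelˡ-≤ c {a} {b} = subst₂ _≤ᴳ_ (c+a-c≡a a) (c+a-c≡a b) ∘ +-monoˡ-≤ (- c)
    where
    open ≡-Reasoning
    c+a-c≡a : ∀ a → c + a + - c ≡ a
    c+a-c≡a a = begin
      c + a + - c    ≡⟨ cong (_+ - c) (+-comm c a) ⟩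
      a + c + - c    ≡⟨ +-assoc a c (- c) ⟩
      a + (c + - c)  ≡⟨ cong (a +_) (+-comm c (- c)) ⟩
      a + (- c + c)  ≡⟨ cong (a +_) (-‿inverseˡ c) ⟩
      a + 0#         ≡⟨ +-comm a 0# ⟩
      0# + a         ≡⟨ +-identityˡ a ⟩
      a              ∎

  ⊕-cancelˡ-≤ₑ : ∀ {x u v} → x ≢ -∞ → _≤ₑ_ G (_⊕_ G x u) (_⊕_ G x v) → _≤ₑ_ G u v
  ⊕-cancelˡ-≤ₑ {x = -∞}                            x≢-∞ _         = ⊥-elim (x≢-∞ refl)
  ⊕-cancelˡ-≤ₑ {x = fin c} {u = -∞}                _    _         = -∞≤
  ⊕-cancelˡ-≤ₑ {x = fin c} {u = fin a} {v = -∞}    _    ()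
  ⊕-cancelˡ-≤ₑ {x = fin c} {u = fin a} {v = fin b} _    (fin≤ le) = fin≤ (+-cancelˡ-≤ c le)

  ⊕-leftComm : ∀ x y z → _⊕_ G x (_⊕_ G y z) ≡ _⊕_ G y (_⊕_ G x z)
  ⊕-leftComm -∞      -∞      _       = refl
  ⊕-leftComm -∞      (fin _) _       = refl
  ⊕-leftComm (fin _) -∞      _       = refl
  ⊕-leftComm (fin _) (fin _) -∞      = refl
  ⊕-leftComm (fin x) (fin y) (fin z) = cong fin (begin
    x + (y + z)  ≡⟨ +-assoc x y z ⟨
    x + y + z    ≡⟨ cong (_+ z) (+-comm x y) ⟩
    y + x + z    ≡⟨ +-assoc y x z ⟩
    y + (x + z)  ∎)
    where open ≡-Reasoning

module _ {G : OrderedAbelianGroup} {n : ℕ} (w : Subset n → Subset n → Ext G) where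

  F : Subset n → Ext G
  F S = w (first ∣ S ∣) S

  module _ (props : Properties G w) where
    open Properties props using (prop-i; prop-ii; prop-iv)

    F-first : ∀ {m} → m ≤ n → F (first m) ≡ w (first m) (first m)
    F-first {m} m≤n = cong (λ c → w (first c) (first m)) (∣first∣ m m≤n)

    w-first≢-∞ : ∀ {m} → m ≤ n → w (first m) (first m) ≢ -∞
    w-first≢-∞ m≤n = prop-i _ ∘ trans (F-first m≤n)

    F-first∪⁅⁆ : ∀ j k → toℕ j ≤ toℕ k →
                 F (first (toℕ j) ∪ ⁅ k ⁆) ≡ _⊕_ G (w (first (toℕ j)) (first (toℕ j))) (w ⁅ j ⁆ ⁅ k ⁆)
    F-first∪⁅⁆ j k j≤k = begin
      F (P ∪ ⁅ k ⁆)                         ≡⟨ cong (λ c → w (first c) (P ∪ ⁅ k ⁆)) ∣P∪⁅k⁆∣≡1+j ⟩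
      w (first (suc (toℕ j))) (P ∪ ⁅ k ⁆)   ≡⟨ cong (λ T → w T (P ∪ ⁅ k ⁆)) (first∪⁅x⁆≡first[1+x] j) ⟨
      w (P ∪ ⁅ j ⁆) (P ∪ ⁅ k ⁆)             ≡⟨ prop-iv P P j k refl (P∪P≪⁅⁆ ≤-refl) (P∪P≪⁅⁆ j≤k) ⟩
      _⊕_ G (w P P) (w ⁅ j ⁆ ⁅ k ⁆)          ∎
      where
      open ≡-Reasoning
      P : Subset n
      P = first (toℕ j)
      ∣P∪⁅k⁆∣≡1+j : ∣ P ∪ ⁅ k ⁆ ∣ ≡ suc (toℕ j)
      ∣P∪⁅k⁆∣≡1+j = trans (∣p∪⁅x⁆∣≡1+∣p∣ P (≤⇒≯ j≤k ∘ ∈first⁻))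
                         (cong suc (∣first∣ (toℕ j) (<⇒≤ (toℕ<n j))))
      P∪P≪⁅⁆ : ∀ {t} → toℕ j ≤ toℕ t → (P ∪ P) ≪ ⁅ t ⁆
      P∪P≪⁅⁆ j≤t = subst (_≪ ⁅ _ ⁆) (sym (∪-idem P)) (first≪⁅⁆ j≤t)

    w⁅t⁆⁅s⁆≡-∞ : ∀ {s t} → toℕ s < toℕ t → w ⁅ t ⁆ ⁅ s ⁆ ≡ -∞
    w⁅t⁆⁅s⁆≡-∞ {s} {t} s<t = prop-ii ⁅ t ⁆ ⁅ s ⁆ (trans (∣⁅x⁆∣≡1 t) (sym (∣⁅x⁆∣≡1 s))) (⁅⁆≺⁅⁆ s<t)

    Submodular⇒w⁅1+j⁆⁅k⁆≤w⁅j⁆⁅k⁆ : Submodular G F → ∀ {j j′ k} →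
                                   toℕ j′ ≡ suc (toℕ j) → toℕ j < toℕ k →
                                   _≤ₑ_ G (w ⁅ j′ ⁆ ⁅ k ⁆) (w ⁅ j ⁆ ⁅ k ⁆)
    Submodular⇒w⁅1+j⁆⁅k⁆≤w⁅j⁆⁅k⁆ submodular {j} {j′} {k} j′≡1+j j<k =
      ⊕-cancelˡ-≤ₑ G (w-first≢-∞ (<⇒≤ (toℕ<n j′)))
        (⊕-cancelˡ-≤ₑ G (w-first≢-∞ (<⇒≤ (toℕ<n j)))
          (subst₂ (_≤ₑ_ G) lhs≡ rhs≡ (Submodular⇒diminishingReturns G submodular P (<⇒≢ j<k ∘ cong toℕ))))
      where
      P P′ : Subset n
      P  = first (toℕ j)
      P′ = first (toℕ j′)
      P∪⁅j⁆≡P′ : P ∪ ⁅ j ⁆ ≡ P′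
      P∪⁅j⁆≡P′ = trans (first∪⁅x⁆≡first[1+x] j) (cong first (sym j′≡1+j))
      lhs≡ : _⊕_ G (F P) (F ((P ∪ ⁅ j ⁆) ∪ ⁅ k ⁆)) ≡ _⊕_ G (w P P) (_⊕_ G (w P′ P′) (w ⁅ j′ ⁆ ⁅ k ⁆))
      lhs≡ = cong₂ (_⊕_ G) (F-first (<⇒≤ (toℕ<n j)))
               (trans (cong (λ S → F (S ∪ ⁅ k ⁆)) P∪⁅j⁆≡P′)
                      (F-first∪⁅⁆ j′ k (subst (_≤ toℕ k) (sym j′≡1+j) j<k)))
      rhs≡ : _⊕_ G (F (P ∪ ⁅ j ⁆)) (F (P ∪ ⁅ k ⁆)) ≡ _⊕_ G (w P P) (_⊕_ G (w P′ P′) (w ⁅ j ⁆ ⁅ k ⁆))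
      rhs≡ = trans (cong₂ (_⊕_ G) (trans (cong F P∪⁅j⁆≡P′) (F-first (<⇒≤ (toℕ<n j′))))
                                  (F-first∪⁅⁆ j k (<⇒≤ j<k)))
                   (⊕-leftComm G _ _ _)

lemma6p3 : (G : OrderedAbelianGroup) (n : ℕ) (w : Subset n → Subset n → Ext G) →
           Properties G w →
           Submodular G (λ S → w (first ∣ S ∣) S) →
           (j j′ k : Fin n) → toℕ j′ ≡ suc (toℕ j) →
           _≤ₑ_ G (w ⁅ j′ ⁆ ⁅ k ⁆) (w ⁅ j ⁆ ⁅ k ⁆)
lemma6p3 G n w props submodular j j′ k j′≡1+j with ≤-<-connex (toℕ k) (toℕ j)
... | inj₁ k≤j = subst (λ x → _≤ₑ_ G x (w ⁅ j ⁆ ⁅ k ⁆)) (sym (w⁅t⁆⁅s⁆≡-∞ w props k<j′)) -∞≤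
  where
  k<j′ : toℕ k < toℕ j′
  k<j′ = subst (toℕ k <_) (sym j′≡1+j) (s≤s k≤j)
... | inj₂ j<k = Submodular⇒w⁅1+j⁆⁅k⁆≤w⁅j⁆⁅k⁆ w props submodular j′≡1+j j<k
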